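{- Let $A$ be a complete lattice and let $F\subseteq A$ be a set of designated values. Then the normal modal extension $\Vdash_{A,F}$ of $\langle A,F\rangle$ is a regular modal extension if and only if $\bigwedge F\in F$ and $F$ is a filter. Here regular means: for every $A$-model $M=\langle W,R,v\rangle$ with $v$ a normal modal valuation, every formula $\psi$ and every $w\in W$, we have $w\Vdash_{A,F}\Box\psi$ if and only if $w'\Vdash_{A,F}\psi$ for every $w'\in W$ with $wRw'$.
   Context: A lattice has join $+$ and meet $.$; a complete lattice may carry an arbitrary unary operation $-$ (no properties assumed). For $S\subseteq A$, $\bigwedge S$ is the greatest lower bound of $S$. A set of designated values of $A$ is a subset $F\subseteq A$ that is upward closed ($a\le b$, $a\in F$ imply $b\in F$); a filter is a set of designated values closed under meet. Formulas are built from a set $Var$ of propositional variables using $\land,\lor,\lnot,\Box$. A Kripke frame is a pair $\langle W,R\rangle$ with $R\subseteq W^2$. For a complete lattice $A$, a normal modal valuation on a frame $\langle W,R\rangle$ is a map $v:W\times \mathrm{Form}\to A$ (write $v_w(\varphi)=v(w,\varphi)$) such that for every $w\in W$: $v_w(\varphi\lor\psi)=v_w(\varphi)+v_w(\psi)$, $v_w(\varphi\land\psi)=v_w(\varphi).v_w(\psi)$, $v_w(\lnot\varphi)=-v_w(\varphi)$, and $v_w(\Box\varphi)=\bigwedge\{v_{w'}(\varphi)\mid wRw'\}$ (variables take arbitrary values in $A$). An $A$-model is $\langle W,R,v\rangle$ with $v$ such a valuation. The normal modal extension $\Vdash_{A,F}$ is defined by $w\Vdash_{A,F}\varphi$ iff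 $v_w(\varphi)\in F$. -}

module Defs where

open import Level using (0ℓ)
open import Data.Nat using (ℕ)
open import Data.Product using (Σ; _×_)
open import Function.Bundles using (_⇔_)
open import Relation.Unary using (Pred; _∈_)
open import Relation.Binary using (Rel)
open import Relation.Binary.PropositionalEquality using (_≡_)
open import Relation.Binary.Lattice.Structures using (IsLattice)
open import Algebra.Core using (Op₁; Op₂)

record CompleteLattice : Set₁ where
  infixr 6 _+_
  infixr 7 _·_
  field
    Carrier   : Set
    _≤_       : Rel Carrier 0ℓ
    _+_       : Op₂ Carrier
    _·_       : Op₂ Carrier
    isLattice : IsLattice _≡_ _≤_ _+_ _·_
    ⋀         : Pred Carrier 0ℓ → Carrier
    ⋀-lower   : ∀ (S : Pred Carrier 0ℓ) a → a ∈ S → ⋀ S ≤ a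
    ⋀-greatest : ∀ (S : Pred Carrier 0ℓ) b → (∀ a → a ∈ S → b ≤ a) → b ≤ ⋀ S

Var : Set
Var = ℕ

data Form : Set where
  var  : Var → Form
  _∧ᶠ_ : Form → Form → Form
  _∨ᶠ_ : Form → Form → Form
  ¬ᶠ_  : Form → Form
  □_   : Form → Form

module _ (A : CompleteLattice) (-_ : Op₁ (CompleteLattice.Carrier A)) where
  open CompleteLattice A

  IsDesignated : Pred Carrier 0ℓ → Set
  IsDesignated F = ∀ a b → a ≤ b → a ∈ F → b ∈ F

  IsFilter : Pred Carrier 0ℓ → Set
  IsFilter F = IsDesignated F × (∀ a b → a ∈ F → b ∈ F → (a · b) ∈ F)

  SuccValues : {W : Set} → (W → W → Set) → (W → Form → Carrier) → W → Form → Pred Carrier 0ℓ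
  SuccValues {W} R v w φ a = Σ W (λ w' → R w w' × v w' φ ≡ a)

  record IsNormalValuation {W : Set} (R : W → W → Set) (v : W → Form → Carrier) : Set where
    field
      v-∨ : ∀ w φ ψ → v w (φ ∨ᶠ ψ) ≡ v w φ + v w ψ
      v-∧ : ∀ w φ ψ → v w (φ ∧ᶠ ψ) ≡ v w φ · v w ψ
      v-¬ : ∀ w φ → v w (¬ᶠ φ) ≡ - v w φ
      v-□ : ∀ w φ → v w (□ φ) ≡ ⋀ (SuccValues R v w φ)

  Forces : (F : Pred Carrier 0ℓ) {W : Set} → (W → Form → Carrier) → W → Form → Set
  Forces F v w φ = v w φ ∈ F

  IsRegular : Pred Carrier 0ℓ → Set₁
  IsRegular F =
    ∀ (W : Set) (R : W → W → Set) (v : W → Form → Carrier) →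
    IsNormalValuation R v →
    ∀ (ψ : Form) (w : W) →
    Forces F v w (□ ψ) ⇔ (∀ (w' : W) → R w w' → Forces F v w' ψ)

{-# OPTIONS --safe #-}
module Submission where

open import Defs
open import Level using (0ℓ)
open import Data.Product using (Σ; _×_; _,_)
open import Function.Base using (id)
open import Function.Bundles using (_⇔_; mk⇔; Equivalence)
open import Relation.Unary using (Pred; _∈_; _⊆_)
open import Relation.Binary.PropositionalEquality using (_≡_; refl; subst; sym)
open import Relation.Binary.Lattice.Structures using (module IsLattice)
open import Algebra.Core using (Op₁)

-- Regularity at a world w says that ⋀ S ∈ F iff S ⊆ F, where S is the set of
-- values of ψ at the successors of w, and every subset S of A arises this way.
-- For upward-closed F the direction ⋀ S ∈ F ⇒ S ⊆ F is automatic, while the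
-- converse for all S is equivalent to ⋀ F ∈ F; and that condition alone
-- already makes F the principal filter generated by ⋀ F.

module _ (A : CompleteLattice) where
  open CompleteLattice A

  ⋀-antitone : ∀ {S T : Pred Carrier 0ℓ} → S ⊆ T → ⋀ T ≤ ⋀ S
  ⋀-antitone S⊆T = ⋀-greatest _ _ (λ a a∈S → ⋀-lower _ a (S⊆T a∈S))

module _ (A : CompleteLattice) (-_ : Op₁ (CompleteLattice.Carrier A)) where
  open CompleteLattice A

  -- The □ clause spells out SuccValues, so that the definition is structurally recursive.
  valuation : {W : Set} → (W → W → Set) → (W → Var → Carrier) → W → Form → Carrier
  valuation R e w (var x)  = e w x
  valuation R e w (φ ∧ᶠ ψ) = valuation R e w φ · valuation R e w ψ
  valuation R e w (φ ∨ᶠ ψ) = valuation R e w φ + valuation R e w ψ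
  valuation R e w (¬ᶠ φ)   = - valuation R e w φ
  valuation {W} R e w (□ φ) = ⋀ (λ a → Σ W (λ w' → R w w' × valuation R e w' φ ≡ a))

  valuation-isNormal : {W : Set} (R : W → W → Set) (e : W → Var → Carrier) →
                       IsNormalValuation A -_ R (valuation R e)
  valuation-isNormal R e = record
    { v-∨ = λ _ _ _ → refl
    ; v-∧ = λ _ _ _ → refl
    ; v-¬ = λ _ _ → refl
    ; v-□ = λ _ _ → refl
    }

module _ (A : CompleteLattice) (-_ : Op₁ (CompleteLattice.Carrier A))
         {F : Pred (CompleteLattice.Carrier A) 0ℓ} (F-upward : IsDesignated A -_ F) where
  open CompleteLattice A
  open IsLattice isLattice using (∧-greatest)

  ⋀∈⇒⊆ : ∀ {S} → ⋀ S ∈ F → S ⊆ F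
  ⋀∈⇒⊆ ⋀S∈F a∈S = F-upward _ _ (⋀-lower _ _ a∈S) ⋀S∈F

  ⋀∈⇒⋀-closed : ⋀ F ∈ F → ∀ {S} → S ⊆ F → ⋀ S ∈ F
  ⋀∈⇒⋀-closed ⋀F∈F S⊆F = F-upward _ _ (⋀-antitone A S⊆F) ⋀F∈F

  ⋀∈⇒isFilter : ⋀ F ∈ F → IsFilter A -_ F
  ⋀∈⇒isFilter ⋀F∈F = F-upward , ·-closed
    where
    ·-closed : ∀ a b → a ∈ F → b ∈ F → (a · b) ∈ F
    ·-closed a b a∈F b∈F =
      F-upward _ _ (∧-greatest (⋀-lower F a a∈F) (⋀-lower F b b∈F)) ⋀F∈F

  ⋀∈⇒isRegular : ⋀ F ∈ F → IsRegular A -_ F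
  ⋀∈⇒isRegular ⋀F∈F W R v v-normal ψ w =
    subst (λ x → x ∈ F ⇔ (∀ w' → R w w' → v w' ψ ∈ F)) (sym (v-□ w ψ))
      (mk⇔ (λ □ψ∈F w' wRw' → ⋀∈⇒⊆ □ψ∈F (w' , wRw' , refl))
           (λ ψ∈F → ⋀∈⇒⋀-closed ⋀F∈F (λ { (w' , wRw' , refl) → ψ∈F w' wRw' })))
    where open IsNormalValuation v-normal

  -- Evaluate regularity in the model whose worlds are the elements of A, where every
  -- world sees exactly S and var 0 denotes the world itself; the root ⋀ S is arbitrary.
  isRegular⇒⋀-closed : IsRegular A -_ F → ∀ {S} → S ⊆ F → ⋀ S ∈ F
  isRegular⇒⋀-closed regular {S} S⊆F =
    F-upward _ _ (⋀-antitone A (λ {a} a∈S → a , a∈S , refl)) □x∈F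
    where
    R : Carrier → Carrier → Set
    R _ w' = w' ∈ S
    e : Carrier → Var → Carrier
    e w _ = w
    v : Carrier → Form → Carrier
    v = valuation A -_ R e
    □x∈F : v (⋀ S) (□ var 0) ∈ F
    □x∈F = Equivalence.from
      (regular Carrier R v (valuation-isNormal A -_ R e) (var 0) (⋀ S)) (λ _ → S⊆F)

mainTheorem1 : (A : CompleteLattice) (-_ : Op₁ (CompleteLattice.Carrier A))
    (F : Pred (CompleteLattice.Carrier A) 0ℓ) →
    IsDesignated A -_ F →
    IsRegular A -_ F ⇔ ((CompleteLattice.⋀ A F ∈ F) × IsFilter A -_ F)
mainTheorem1 A -_ F F-upward = mk⇔
  (λ regular → let ⋀F∈F = isRegular⇒⋀-closed A -_ F-upward regular id
               in ⋀F∈F , ⋀∈⇒isFilter A -_ F-upward ⋀F∈F)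
  (λ (⋀F∈F , _) → ⋀∈⇒isRegular A -_ F-upward ⋀F∈F)
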